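{- Let $(p\colon\mathbb{E}\to\mathbb{B},O,\Omega)$ be a $\mathbf{CLat}_\sqcap$-fibration with truth values indexed by discrete $A$, $F\colon\mathbb{B}\to\mathbb{B}$ and $\tau\colon F\circ O\Rightarrow O$. Assume each hom-set $\mathbb{B}(X,O(a))$ carries a complete lattice order with join $\bigvee$. Then a pair $(X,S)$ with $S(a)\subseteq\mathbb{B}(X,O(a))$ for each $a$ is approximating to $F^{\Omega}_{\tau}$ if for each $a\in A$: (1) for each $X'$ and $S'\subseteq\mathbb{B}(X',O(a))$, $\tau_a\circ F(\bigvee_{f\in S'}f)=\bigvee_{f\in S'}\tau_a\circ Ff$; (2) for each $X'$ and $S'\subseteq\mathbb{B}(X',O(a))$, $\bigwedge_{f\in S'}f^*\Omega(a)\sqsubseteq(\bigvee_{f\in S'}f)^*\Omega(a)$; (3) for each $k\in\mathbb{E}(\bigwedge_{a'\in A,\,k'\in S(a')}k'^*\Omega(a'),\,\Omega(a))$ there is $S'_k\subseteq S(a)$ with $pk=\bigvee_{k'\in S'_k}k'$. Moreover, if these conditions hold, then for each $a\in A$, $(X,S(a))$ is approximating to the single-parameter lifting $F^{\Omega(a)}_{\tau_a}$.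
   Context: A $\mathbf{CLat}_\sqcap$-fibration has complete-lattice fibers (order $\sqsubseteq$, meet $\bigwedge$) and meet-preserving reindexing; $O=p\circ\Omega$. $F^{\Omega}_{\tau}(P)=\bigwedge_{a\in A,\,k\in\mathbb{E}(P,\Omega(a))}(\tau_a\circ F(pk))^*\Omega(a)$. $(X,S)$ is approximating to $F^{\Omega}_{\tau}$ if for each $a\in A$ and each $k\in\mathbb{E}(\bigwedge_{a'\in A,\,k'\in S(a')}k'^*\Omega(a'),\,\Omega(a))$ we have $\bigwedge_{a'\in A,\,k'\in S(a')}(\tau_{a'}\circ Fk')^*\Omega(a')\sqsubseteq(\tau_a\circ F(pk))^*\Omega(a)$ (the single-parameter version for $(X,S(a))$ and $F^{\Omega(a)}_{\tau_a}$ uses $A=1$ with $\Omega(a),\tau_a$). -}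

module Defs where

open import Level using (Level; suc; _⊔_)
open import Data.Product using (Σ; Σ-syntax; _×_; _,_; proj₁; proj₂)
open import Data.Unit.Polymorphic using (⊤; tt)
open import Relation.Binary.PropositionalEquality using (_≡_)

record Category (ℓ : Level) : Set (suc ℓ) where
  infixr 9 _∘_
  field
    Obj   : Set ℓ
    Hom   : Obj → Obj → Set ℓ
    id    : ∀ {X} → Hom X X
    _∘_   : ∀ {X Y Z} → Hom Y Z → Hom X Y → Hom X Z
    idˡ   : ∀ {X Y} (f : Hom X Y) → id ∘ f ≡ f
    idʳ   : ∀ {X Y} (f : Hom X Y) → f ∘ id ≡ f
    assoc : ∀ {W X Y Z} (h : Hom Y Z) (g : Hom X Y) (f : Hom W X) →
            (h ∘ g) ∘ f ≡ h ∘ (g ∘ f)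

record Functor {ℓ} (C : Category ℓ) : Set ℓ where
  open Category C
  field
    F₀    : Obj → Obj
    F₁    : ∀ {X Y} → Hom X Y → Hom (F₀ X) (F₀ Y)
    F-id  : ∀ {X} → F₁ (id {X}) ≡ id
    F-∘   : ∀ {X Y Z} (g : Hom Y Z) (f : Hom X Y) → F₁ (g ∘ f) ≡ F₁ g ∘ F₁ f

-- A CLat_⊓-fibration p : 𝔼 → 𝔹 over 𝔹 = C, presented by its fibres:
-- each fibre Fib X is a complete lattice (order ⊑, meets ⋀ of arbitrary
-- ℓ-small families), and reindexing f * preserves meets (functorially).
record CLatFibration {ℓ} (C : Category ℓ) : Set (suc ℓ) where
  open Category C
  infix 4 _⊑_
  field
    Fib       : Obj → Set ℓ
    _⊑_       : ∀ {X} → Fib X → Fib X → Set ℓ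
    ⊑-refl    : ∀ {X} {P : Fib X} → P ⊑ P
    ⊑-trans   : ∀ {X} {P Q R : Fib X} → P ⊑ Q → Q ⊑ R → P ⊑ R
    ⊑-antisym : ∀ {X} {P Q : Fib X} → P ⊑ Q → Q ⊑ P → P ≡ Q
    ⋀         : ∀ {X} {I : Set ℓ} → (I → Fib X) → Fib X
    ⋀-lb      : ∀ {X} {I : Set ℓ} (P : I → Fib X) (i : I) → ⋀ P ⊑ P i
    ⋀-glb     : ∀ {X} {I : Set ℓ} (P : I → Fib X) (Q : Fib X) →
                (∀ i → Q ⊑ P i) → Q ⊑ ⋀ P
    _*        : ∀ {X Y} → Hom X Y → Fib Y → Fib X
    *-mono    : ∀ {X Y} (f : Hom X Y) {P Q : Fib Y} → P ⊑ Q → (f *) P ⊑ (f *) Q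
    *-id      : ∀ {X} (P : Fib X) → (id *) P ≡ P
    *-∘       : ∀ {X Y Z} (g : Hom Y Z) (f : Hom X Y) (P : Fib Z) →
                ((g ∘ f) *) P ≡ (f *) ((g *) P)
    *-⋀       : ∀ {X Y} (f : Hom X Y) {I : Set ℓ} (P : I → Fib Y) →
                (f *) (⋀ P) ≡ ⋀ (λ i → (f *) (P i))

  -- Morphisms of the total category 𝔼 from P (over X) to Q (over Y):
  -- since fibres are posets, such a morphism is a base morphism f with
  -- P ⊑ f* Q.  The projection p sends it to f.
  EHom : ∀ {X Y} → Fib X → Fib Y → Set ℓ
  EHom {X} {Y} P Q = Σ[ f ∈ Hom X Y ] (P ⊑ (f *) Q)

  p₁ : ∀ {X Y} {P : Fib X} {Q : Fib Y} → EHom P Q → Hom X Y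
  p₁ = proj₁

record HomJoins {ℓ} (C : Category ℓ) (A : Set ℓ) (O : A → Category.Obj C)
       : Set (suc ℓ) where
  open Category C
  infix 4 _≤_
  field
    _≤_       : ∀ {Y a} → Hom Y (O a) → Hom Y (O a) → Set ℓ
    ≤-refl    : ∀ {Y a} {f : Hom Y (O a)} → f ≤ f
    ≤-trans   : ∀ {Y a} {f g h : Hom Y (O a)} → f ≤ g → g ≤ h → f ≤ h
    ≤-antisym : ∀ {Y a} {f g : Hom Y (O a)} → f ≤ g → g ≤ f → f ≡ g
    ⋁         : ∀ {Y a} {I : Set ℓ} → (I → Hom Y (O a)) → Hom Y (O a)
    ⋁-ub      : ∀ {Y a} {I : Set ℓ} (f : I → Hom Y (O a)) (i : I) → f i ≤ ⋁ f
    ⋁-lub     : ∀ {Y a} {I : Set ℓ} (f : I → Hom Y (O a)) (g : Hom Y (O a)) →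
                (∀ i → f i ≤ g) → ⋁ f ≤ g

  ⋁ₛ : ∀ {Y a} → (Hom Y (O a) → Set ℓ) → Hom Y (O a)
  ⋁ₛ {Y} {a} S' = ⋁ {Y} {a} {Σ (Hom Y (O a)) S'} proj₁

module _ {ℓ} (C : Category ℓ) (E : CLatFibration C) where
  open Category C
  open CLatFibration E

  LiftΩτ : (A : Set ℓ) (O : A → Obj) (Ω : (a : A) → Fib (O a))
           (F : Functor C) (τ : (a : A) → Hom (Functor.F₀ F (O a)) (O a)) →
           ∀ {X} → Fib X → Fib (Functor.F₀ F X)
  LiftΩτ A O Ω F τ {X} P =
    ⋀ {I = Σ[ a ∈ A ] EHom P (Ω a)}
      (λ { (a , k) → ((τ a ∘ Functor.F₁ F (p₁ k)) *) (Ω a) })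

  Approximating : (A : Set ℓ) (O : A → Obj) (Ω : (a : A) → Fib (O a))
                  (F : Functor C) (τ : (a : A) → Hom (Functor.F₀ F (O a)) (O a))
                  (X : Obj) (S : (a : A) → Hom X (O a) → Set ℓ) → Set ℓ
  Approximating A O Ω F τ X S =
    (a : A) →
    (k : EHom (⋀ {I = Σ[ a' ∈ A ] Σ (Hom X (O a')) (S a')}
                 (λ { (a' , k' , _) → (k' *) (Ω a') }))
              (Ω a)) →
    ⋀ {I = Σ[ a' ∈ A ] Σ (Hom X (O a')) (S a')}
      (λ { (a' , k' , _) → ((τ a' ∘ Functor.F₁ F k') *) (Ω a') })
    ⊑ ((τ a ∘ Functor.F₁ F (p₁ k)) *) (Ω a)

  ApproximatingSingle : (A : Set ℓ) (O : A → Obj) (Ω : (a : A) → Fib (O a))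
                        (F : Functor C) (τ : (a : A) → Hom (Functor.F₀ F (O a)) (O a))
                        (X : Obj) (S : (a : A) → Hom X (O a) → Set ℓ) → A → Set ℓ
  ApproximatingSingle A O Ω F τ X S a =
    Approximating ⊤ (λ _ → O a) (λ _ → Ω a) F (λ _ → τ a) X (λ _ → S a)

  module _ (A : Set ℓ) (O : A → Obj) (Ω : (a : A) → Fib (O a))
           (F : Functor C) (τ : (a : A) → Hom (Functor.F₀ F (O a)) (O a))
           (L : HomJoins C A O) (X : Obj) (S : (a : A) → Hom X (O a) → Set ℓ) where
    open Functor F
    open HomJoins L

    Cond1 : A → Set (suc ℓ)
    Cond1 a = (X' : Obj) (S' : Hom X' (O a) → Set ℓ) →
      τ a ∘ F₁ (⋁ₛ S') ≡ ⋁ {F₀ X'} {a} {Σ (Hom X' (O a)) S'}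
                            (λ { (f , _) → τ a ∘ F₁ f })

    Cond2 : A → Set (suc ℓ)
    Cond2 a = (X' : Obj) (S' : Hom X' (O a) → Set ℓ) →
      ⋀ {I = Σ (Hom X' (O a)) S'} (λ { (f , _) → (f *) (Ω a) })
      ⊑ ((⋁ₛ S') *) (Ω a)

    Cond3 : A → Set (suc ℓ)
    Cond3 a =
      (k : EHom (⋀ {I = Σ[ a' ∈ A ] Σ (Hom X (O a')) (S a')}
                   (λ { (a' , k' , _) → (k' *) (Ω a') }))
                (Ω a)) →
      Σ[ S'k ∈ (Hom X (O a) → Set ℓ) ]
        ((∀ f → S'k f → S a f) × (p₁ k ≡ ⋁ₛ S'k))

-- Condition (1) turns τ_a ∘ F(⋁ T) into the join of the maps τ_a ∘ Ff (f ∈ T),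
-- and condition (2) says that Ω(a) reindexed along a join lies above the meet
-- of its reindexings along the joinands.  Hence every predicate below all
-- (τ_a ∘ Ff)* Ω(a) with f ∈ T is also below (τ_a ∘ F(⋁ T))* Ω(a).  By (3) the
-- map p k underlying any k from ⋀ k'* Ω(a') to Ω(a) is such a join with
-- T ⊆ S(a), which gives both approximation properties at once.
module Submission where

open import Defs
open import Level using (Level)
open import Data.Product using (_×_; Σ; Σ-syntax; _,_; proj₁)
open import Data.Unit.Polymorphic using (tt)
open import Relation.Binary.PropositionalEquality using (_≡_; refl; subst; sym; trans; cong)

module MeetProperties {ℓ : Level} {C : Category ℓ} (E : CLatFibration C) where
  open Category C
  open CLatFibration E

  ⋀-⊑-⋀∘ : ∀ {X} {I J : Set ℓ} (P : I → Fib X) (g : J → I) → ⋀ P ⊑ ⋀ (λ j → P (g j))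
  ⋀-⊑-⋀∘ P g = ⋀-glb _ (⋀ P) (λ j → ⋀-lb P (g j))

  ⊑-*-≡ : ∀ {X Y} {Q : Fib X} {R : Fib Y} {f g : Hom X Y} →
          f ≡ g → Q ⊑ (f *) R → Q ⊑ (g *) R
  ⊑-*-≡ {Q = Q} {R} = subst (λ h → Q ⊑ (h *) R)

module JoinProperties {ℓ : Level} {C : Category ℓ} {A : Set ℓ} {O : A → Category.Obj C}
                      (L : HomJoins C A O) where
  open Category C
  open HomJoins L

  Image : ∀ {Y a} {I : Set ℓ} → (I → Hom Y (O a)) → Hom Y (O a) → Set ℓ
  Image {I = I} f g = Σ[ i ∈ I ] f i ≡ g

  ⋁ₛ-Image : ∀ {Y a} {I : Set ℓ} (f : I → Hom Y (O a)) → ⋁ₛ (Image f) ≡ ⋁ f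
  ⋁ₛ-Image {Y} {a} f = ≤-antisym
    (⋁-lub proj₁ (⋁ f) (λ { (g , i , refl) → ⋁-ub f i }))
    (⋁-lub f (⋁ₛ (Image f))
       (λ i → ⋁-ub {I = Σ (Hom Y (O a)) (Image f)} proj₁ (f i , i , refl)))

module Approximation {ℓ : Level} (C : Category ℓ) (E : CLatFibration C)
         (A : Set ℓ) (O : A → Category.Obj C)
         (Ω : (a : A) → CLatFibration.Fib E (O a))
         (F : Functor C)
         (τ : (a : A) → Category.Hom C (Functor.F₀ F (O a)) (O a))
         (L : HomJoins C A O)
         (X : Category.Obj C) (S : (a : A) → Category.Hom C X (O a) → Set ℓ) where
  open Category C
  open CLatFibration E
  open Functor F
  open HomJoins L
  open MeetProperties E
  open JoinProperties L

  ⋀-τF-⊑-τF-⋁ₛ : ∀ a → Cond1 C E A O Ω F τ L X S a → Cond2 C E A O Ω F τ L X S a →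
                 (T : Hom X (O a) → Set ℓ) →
                 ⋀ {I = Σ (Hom X (O a)) T} (λ { (f , _) → ((τ a ∘ F₁ f) *) (Ω a) })
                 ⊑ ((τ a ∘ F₁ (⋁ₛ T)) *) (Ω a)
  ⋀-τF-⊑-τF-⋁ₛ a cond1 cond2 T =
    ⊑-*-≡ (sym τF⋁ₛT≡⋁ₛImage)
      (⊑-trans (⋀-glb _ _ (λ { (g , i , refl) → ⋀-lb _ i }))
               (cond2 (F₀ X) (Image τF)))
    where
    τF : Σ (Hom X (O a)) T → Hom (F₀ X) (O a)
    τF (f , _) = τ a ∘ F₁ f

    τF⋁ₛT≡⋁ₛImage : τ a ∘ F₁ (⋁ₛ T) ≡ ⋁ₛ (Image τF)
    τF⋁ₛT≡⋁ₛImage = trans (cond1 X T) (sym (⋁ₛ-Image τF))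

  ⊑-τF-p₁ : ∀ a → Cond1 C E A O Ω F τ L X S a → Cond2 C E A O Ω F τ L X S a →
            Cond3 C E A O Ω F τ L X S a → (Q : Fib (F₀ X)) →
            (∀ f → S a f → Q ⊑ ((τ a ∘ F₁ f) *) (Ω a)) →
            (k : EHom (⋀ {I = Σ[ a' ∈ A ] Σ (Hom X (O a')) (S a')}
                         (λ { (a' , k' , _) → (k' *) (Ω a') }))
                      (Ω a)) →
            Q ⊑ ((τ a ∘ F₁ (p₁ k)) *) (Ω a)
  ⊑-τF-p₁ a cond1 cond2 cond3 Q Q⊑τF k with cond3 k
  ... | T , T⊆Sa , p₁k≡⋁ₛT =
    ⊑-*-≡ (cong (λ h → τ a ∘ F₁ h) (sym p₁k≡⋁ₛT))
      (⊑-trans (⋀-glb _ Q (λ { (f , t) → Q⊑τF f (T⊆Sa f t) }))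
               (⋀-τF-⊑-τF-⋁ₛ a cond1 cond2 T))

proposition5 : ∀ {ℓ : Level} (C : Category ℓ) (E : CLatFibration C)
    (A : Set ℓ) (O : A → Category.Obj C)
    (Ω : (a : A) → CLatFibration.Fib E (O a))
    (F : Functor C)
    (τ : (a : A) → Category.Hom C (Functor.F₀ F (O a)) (O a))
    (L : HomJoins C A O)
    (X : Category.Obj C) (S : (a : A) → Category.Hom C X (O a) → Set ℓ) →
    ((a : A) → Cond1 C E A O Ω F τ L X S a
    × Cond2 C E A O Ω F τ L X S a
    × Cond3 C E A O Ω F τ L X S a) →
    Approximating C E A O Ω F τ X S
    × ((a : A) → ApproximatingSingle C E A O Ω F τ X S a)
proposition5 C E A O Ω F τ L X S conds = approximating , approximatingSingle
  where
  open CLatFibration E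
  open MeetProperties E
  open Approximation C E A O Ω F τ L X S

  approximating : Approximating C E A O Ω F τ X S
  approximating a k with conds a
  ... | cond1 , cond2 , cond3 =
    ⊑-τF-p₁ a cond1 cond2 cond3 _
      (λ f s → ⋀-lb _ (a , f , s)) k

  approximatingSingle : (a : A) → ApproximatingSingle C E A O Ω F τ X S a
  approximatingSingle a tt (h , ⋀Sa⊑h*Ωa) with conds a
  ... | cond1 , cond2 , cond3 =
    ⊑-τF-p₁ a cond1 cond2 cond3 _
      (λ f s → ⋀-lb _ (tt , f , s))
      -- k starts from the meet over S(a) alone, which lies above the meet over all of S
      (h , ⊑-trans (⋀-⊑-⋀∘ _ (λ { (tt , f , s) → (a , f , s) })) ⋀Sa⊑h*Ωa)
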